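{- Let $\mathcal{C} = (\mathfrak{G},\to)$ be a combinatory logic system. If $\mathcal{C}$ is hierarchical, then $\mathcal{C}$ is locally finite (every $\equiv$-equivalence class of $\mathfrak{G}$-terms is finite) and all the $\mathfrak{G}$-terms of a same connected component of the rewrite graph of $\mathcal{C}$ have the same height.
   Context: $\mathfrak{G}$ is a finite set of constants. $\mathfrak{G}$-terms: variables $\mathsf{x}_i$ ($i\ge1$), constants of $\mathfrak{G}$, and applications $\mathfrak{t}_1\mathfrak{t}_2$ (binary trees with leaves labeled by variables or constants; juxtaposition associates to the left). The depth of a node is the number of internal (application) nodes on the path from the root to it; the height of a term is the maximal depth of its nodes. For terms $\mathfrak{t},\mathfrak{s}_1,\dots,\mathfrak{s}_n$, $\mathfrak{t}[\mathfrak{s}_1,\dots,\mathfrak{s}_n]$ denotes simultaneous substitution of $\mathfrak{s}_i$ for $\mathsf{x}_i$. A combinatory logic system (CLS) $(\mathfrak{G},\to)$ has, for each constant $X\in\mathfrak{G}$, exactly one rule $X\mathsf{x}_1\cdots\mathsf{x}_n\to\mathfrak{t}_X$ with $n\ge1$ (the order of $X$) and $\mathfrak{t}_X$ a term with no constants and all variables among $\mathsf{x}_1,\dots,\mathsf{x}_n$, and no other rules. The context closure $\Rightarrow$: $\mathfrak{t}\Rightarrow\mathfrak{t}'$ iff $\mathfrak{t}'$ is obtained from $\mathfrak{t}$ by replacing one subterm of the form $X\mathfrak{s}_1\cdots\mathfrak{s}_n$ by $\mathfrak{t}_X[\mathfrak{s}_1,\dots,\mathfrak{s}_n]$. $\equiv$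 is the reflexive, symmetric, transitive closure of $\Rightarrow$; the rewrite graph has all terms as vertices and an arc $\mathfrak{t}\to\mathfrak{t}'$ whenever $\mathfrak{t}\Rightarrow\mathfrak{t}'$ (its connected components are the $\equiv$-classes). A constant $X$ of order $n$ is hierarchical if for every $i\in[n]$, the variable $\mathsf{x}_i$ appears in $\mathfrak{t}_X$ at depth $n+1-i$ (every occurrence of $\mathsf{x}_i$ in $\mathfrak{t}_X$ is at that depth and there is at least one); the CLS is hierarchical if all its constants are. -}

module Defs where

open import Data.Nat using (ℕ; zero; suc; _≤_; _∸_; _⊔_)
open import Data.Fin using (Fin; toℕ)
open import Data.Empty using (⊥)
open import Data.Product using (∃; _×_)
open import Data.List using (List)
open import Data.List.Membership.Propositional using (_∈_)
open import Relation.Binary.PropositionalEquality using (_≡_)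
open import Relation.Binary.Construct.Closure.Equivalence using (EqClosure)

data Tm (C V : Set) : Set where
  var : V → Tm C V
  con : C → Tm C V
  _·_ : Tm C V → Tm C V → Tm C V

infixl 9 _·_

height : ∀ {C V} → Tm C V → ℕ
height (var _) = 0
height (con _) = 0
height (t · s) = suc (height t ⊔ height s)

data OccursAt {C V : Set} : Tm C V → V → ℕ → Set where
  here  : ∀ {x} → OccursAt (var x) x 0
  left  : ∀ {t s x d} → OccursAt t x d → OccursAt (t · s) x (suc d)
  right : ∀ {t s x d} → OccursAt s x d → OccursAt (t · s) x (suc d)

subst : ∀ {C V n} → (Fin n → Tm C V) → Tm ⊥ (Fin n) → Tm C V
subst σ (var i) = σ i
subst σ (con ())
subst σ (t · s) = subst σ t · subst σ s

applyArgs : ∀ {C V} → Tm C V → (n : ℕ) → (Fin n → Tm C V) → Tm C V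
applyArgs h zero    σ = h
applyArgs h (suc n) σ = applyArgs h n (λ i → σ (Data.Fin.inject₁ i)) · σ (Data.Fin.fromℕ n)

record CLS : Set where
  field
    k     : ℕ
    order : Fin k → ℕ
    order≥1 : ∀ X → 1 ≤ order X
    -- right-hand side t_X : no constants, variables among x₁ … xₙ
    -- (Fin n index i stands for x_{i+1})
    rhs   : (X : Fin k) → Tm ⊥ (Fin (order X))

module _ (𝒞 : CLS) where
  open CLS 𝒞

  -- 𝔊-terms; variables x_i (i ≥ 1) are encoded as var (i - 1) with i-1 : ℕ
  Term : Set
  Term = Tm (Fin k) ℕ

  data _⇒_ : Term → Term → Set where
    rule : (X : Fin k) (σ : Fin (order X) → Term) →
           applyArgs (con X) (order X) σ ⇒ subst σ (rhs X)
    appL : ∀ {t t′ s} → t ⇒ t′ → (t · s) ⇒ (t′ · s)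
    appR : ∀ {t s s′} → s ⇒ s′ → (t · s) ⇒ (t · s′)

  _≋_ : Term → Term → Set
  _≋_ = EqClosure _⇒_

  -- X of order n is hierarchical: for each i ∈ [n] (here Fin index j = i-1),
  -- x_i occurs in t_X, and every occurrence is at depth n + 1 - i = n - j.
  Hierarchical : Fin k → Set
  Hierarchical X = ∀ (j : Fin (order X)) →
    (OccursAt (rhs X) j (order X ∸ toℕ j)) ×
    (∀ d → OccursAt (rhs X) j d → d ≡ order X ∸ toℕ j)

  IsHierarchical : Set
  IsHierarchical = ∀ X → Hierarchical X

  LocallyFinite : Set
  LocallyFinite = ∀ (t : Term) → ∃ λ (L : List Term) → ∀ s → t ≋ s → s ∈ L

{-# OPTIONS --safe #-}
module Submission where

-- A constant-free term t instantiated as t[s₁,…,sₙ] has height max (d + height sⱼ) over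
-- the occurrences of xⱼ at depth d in t.  In a hierarchical rule X x₁ ⋯ xₙ → t_X every xᵢ
-- sits at depth n + 1 - i on both sides, and the head X at depth n on the left is matched
-- by x₁ at depth n on the right, so both sides of every instance have the same height;
-- they also contain the same variables.  Hence an ≡-class has a single height and a single
-- set of variables, and there are only finitely many terms of bounded height over finitely
-- many constants and variables.

open import Defs
open import Data.Empty using (⊥)
open import Data.Fin using (Fin; toℕ; inject₁; fromℕ; fromℕ<)
open import Data.Fin.Properties using (toℕ-inject₁; toℕ-fromℕ; toℕ-fromℕ<; toℕ≤n)
open import Data.Fin.Relation.Unary.Top using (view; ‵fromℕ; ‵inject₁)
open import Data.List using (List; []; _∷_; _++_; map; cartesianProductWith; allFin)
open import Data.List.Membership.Propositional using (_∈_)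
open import Data.List.Membership.Propositional.Properties
  using (∈-++⁺ˡ; ∈-++⁺ʳ; ∈-map⁺; ∈-allFin; ∈-cartesianProductWith⁺)
open import Data.List.Relation.Unary.Any using (here)
open import Data.Nat using (ℕ; zero; suc; _+_; _∸_; _⊔_; _≤_; z≤n; s≤s; s≤s⁻¹)
open import Data.Nat.Properties
  using (≤-refl; ≤-trans; ≤-reflexive; ≤-antisym; m≤m⊔n; m≤n⊔m; ⊔-lub; m≤m+n; +-∸-assoc; m+n∸n≡m)
open import Data.Product using (_×_; _,_; ∃; proj₁; proj₂)
open import Function.Base using (id)
open import Function.Bundles using (_⇔_; mk⇔; Equivalence)
open import Function.Properties.Equivalence using (⇔-isEquivalence)
open import Relation.Binary.Structures using (IsEquivalence)
open import Relation.Binary.PropositionalEquality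
  using (_≡_; refl; sym; trans; cong; isEquivalence)
open import Relation.Binary.Construct.Closure.Equivalence using (gfold)

infix 4 _∈ᵥ_

_∈ᵥ_ : ∀ {C V} → V → Tm C V → Set
x ∈ᵥ t = ∃ (OccursAt t x)

hasVar : ∀ {V} (u : Tm ⊥ V) → ∃ λ j → j ∈ᵥ u
hasVar (var j) = j , 0 , here
hasVar (con ())
hasVar (u · v) with hasVar u
... | j , d , o = j , suc d , left o

SameVars : ∀ {C V} → Tm C V → Tm C V → Set
SameVars t s = ∀ x → x ∈ᵥ t ⇔ x ∈ᵥ s

sameVars-isEquivalence : ∀ {C V} → IsEquivalence (SameVars {C} {V})
sameVars-isEquivalence = record
  { refl  = λ x → refl′
  ; sym   = λ p x → sym′ (p x)
  ; trans = λ p q x → trans′ (p x) (q x)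
  }
  where open IsEquivalence ⇔-isEquivalence renaming (refl to refl′; sym to sym′; trans to trans′)

∈ᵥ-·-map : ∀ {C V x} {t t′ s s′ : Tm C V} →
           (x ∈ᵥ t → x ∈ᵥ t′) → (x ∈ᵥ s → x ∈ᵥ s′) → x ∈ᵥ t · s → x ∈ᵥ t′ · s′
∈ᵥ-·-map f g (_ , left o)  with f (_ , o)
... | _ , o′ = _ , left o′
∈ᵥ-·-map f g (_ , right o) with g (_ , o)
... | _ , o′ = _ , right o′

·-sameVars : ∀ {C V} {t t′ s s′ : Tm C V} →
             SameVars t t′ → SameVars s s′ → SameVars (t · s) (t′ · s′)
·-sameVars t≈t′ s≈s′ x = mk⇔ (∈ᵥ-·-map (to (t≈t′ x)) (to (s≈s′ x)))
                             (∈ᵥ-·-map (from (t≈t′ x)) (from (s≈s′ x)))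
  where open Equivalence

module _ {C V : Set} {n : ℕ} (σ : Fin n → Tm C V) where

  height-subst-≥ : ∀ {u j d} → OccursAt u j d → d + height (σ j) ≤ height (subst σ u)
  height-subst-≥ here      = ≤-refl
  height-subst-≥ (left o)  = s≤s (≤-trans (height-subst-≥ o) (m≤m⊔n _ _))
  height-subst-≥ (right o) = s≤s (≤-trans (height-subst-≥ o) (m≤n⊔m _ _))

  height-subst-≤ : ∀ (u : Tm ⊥ (Fin n)) {K} →
                   (∀ j d → OccursAt u j d → d + height (σ j) ≤ K) →
                   height (subst σ u) ≤ K
  height-subst-≤ (var j) H = H j 0 here
  height-subst-≤ (con ())
  height-subst-≤ (u · v) {zero} H with hasVar u
  ... | j , d , o with H j (suc d) (left o)
  ... | ()
  height-subst-≤ (u · v) {suc K} H = s≤s (⊔-lub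
    (height-subst-≤ u (λ j d o → s≤s⁻¹ (H j (suc d) (left o))))
    (height-subst-≤ v (λ j d o → s≤s⁻¹ (H j (suc d) (right o)))))

  ∈ᵥ-subst⁺ : ∀ {u j d x} → OccursAt u j d → x ∈ᵥ σ j → x ∈ᵥ subst σ u
  ∈ᵥ-subst⁺ here      x∈σj = x∈σj
  ∈ᵥ-subst⁺ (left o)  x∈σj with ∈ᵥ-subst⁺ o x∈σj
  ... | _ , o′ = _ , left o′
  ∈ᵥ-subst⁺ (right o) x∈σj with ∈ᵥ-subst⁺ o x∈σj
  ... | _ , o′ = _ , right o′

  ∈ᵥ-subst⁻ : ∀ (u : Tm ⊥ (Fin n)) {x} → x ∈ᵥ subst σ u → ∃ λ j → x ∈ᵥ σ j
  ∈ᵥ-subst⁻ (var j) x∈σj         = j , x∈σj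
  ∈ᵥ-subst⁻ (con ())
  ∈ᵥ-subst⁻ (u · v) (_ , left o)  = ∈ᵥ-subst⁻ u (_ , o)
  ∈ᵥ-subst⁻ (u · v) (_ , right o) = ∈ᵥ-subst⁻ v (_ , o)

reindexDepth : ∀ {a b h K} → a ≡ b → a + h ≤ K → b + h ≤ K
reindexDepth refl a+h≤K = a+h≤K

argDepth-inject₁ : ∀ m (i : Fin m) → suc m ∸ toℕ (inject₁ i) ≡ suc (m ∸ toℕ i)
argDepth-inject₁ m i = trans (cong (suc m ∸_) (toℕ-inject₁ i)) (+-∸-assoc 1 (toℕ≤n i))

argDepth-fromℕ : ∀ m → suc m ∸ toℕ (fromℕ m) ≡ 1
argDepth-fromℕ m = trans (cong (suc m ∸_) (toℕ-fromℕ m)) (m+n∸n≡m 1 m)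

module _ {C V : Set} (c : C) where

  height-applyArgs-≥ : ∀ m (σ : Fin m → Tm C V) i →
                       m ∸ toℕ i + height (σ i) ≤ height (applyArgs (con c) m σ)
  height-applyArgs-≥ (suc m) σ i with view i
  ... | ‵fromℕ     = reindexDepth (sym (argDepth-fromℕ m)) (s≤s (m≤n⊔m _ _))
  ... | ‵inject₁ j = reindexDepth (sym (argDepth-inject₁ m j))
                       (s≤s (≤-trans (height-applyArgs-≥ m (λ j → σ (inject₁ j)) j) (m≤m⊔n _ _)))

  height-applyArgs-≤ : ∀ m (σ : Fin m → Tm C V) {K} → m ≤ K →
                       (∀ i → m ∸ toℕ i + height (σ i) ≤ K) →
                       height (applyArgs (con c) m σ) ≤ K
  height-applyArgs-≤ zero    σ _           _ = z≤n
  height-applyArgs-≤ (suc m) σ (s≤s m≤K) H = s≤s (⊔-lub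
    (height-applyArgs-≤ m (λ i → σ (inject₁ i)) m≤K λ i →
      s≤s⁻¹ (reindexDepth (argDepth-inject₁ m i) (H (inject₁ i))))
    (s≤s⁻¹ (reindexDepth (argDepth-fromℕ m) (H (fromℕ m)))))

  ∈ᵥ-applyArgs⁺ : ∀ m (σ : Fin m → Tm C V) i {x} → x ∈ᵥ σ i → x ∈ᵥ applyArgs (con c) m σ
  ∈ᵥ-applyArgs⁺ (suc m) σ i x∈σi with view i
  ... | ‵fromℕ = _ , right (proj₂ x∈σi)
  ... | ‵inject₁ j with ∈ᵥ-applyArgs⁺ m (λ j → σ (inject₁ j)) j x∈σi
  ...   | _ , o = _ , left o

  ∈ᵥ-applyArgs⁻ : ∀ m (σ : Fin m → Tm C V) {x} → x ∈ᵥ applyArgs (con c) m σ → ∃ λ i → x ∈ᵥ σ i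
  ∈ᵥ-applyArgs⁻ (suc m) σ (_ , left o) with ∈ᵥ-applyArgs⁻ m (λ i → σ (inject₁ i)) (_ , o)
  ... | i , x∈σi = inject₁ i , x∈σi
  ∈ᵥ-applyArgs⁻ (suc m) σ (_ , right o) = fromℕ m , _ , o

vars : ∀ {C V} → Tm C V → List V
vars (var x) = x ∷ []
vars (con _) = []
vars (t · s) = vars t ++ vars s

∈-vars : ∀ {C V x} (t : Tm C V) → x ∈ᵥ t → x ∈ vars t
∈-vars (var x) (_ , here)    = here refl
∈-vars (t · s) (_ , left o)  = ∈-++⁺ˡ (∈-vars t (_ , o))
∈-vars (t · s) (_ , right o) = ∈-++⁺ʳ (vars t) (∈-vars s (_ , o))

module _ {C V : Set} (cs : List C) (xs : List V) where

  leaves : List (Tm C V)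
  leaves = map var xs ++ map con cs

  terms : ℕ → List (Tm C V)
  terms zero    = leaves
  terms (suc h) = leaves ++ cartesianProductWith _·_ (terms h) (terms h)

  leaves⊆terms : ∀ h {t} → t ∈ leaves → t ∈ terms h
  leaves⊆terms zero    t∈ = t∈
  leaves⊆terms (suc h) t∈ = ∈-++⁺ˡ t∈

  ∈-terms : (∀ c → c ∈ cs) → ∀ h (t : Tm C V) → height t ≤ h → (∀ x → x ∈ᵥ t → x ∈ xs) →
            t ∈ terms h
  ∈-terms allC h (var x) _ V = leaves⊆terms h (∈-++⁺ˡ (∈-map⁺ var (V x (_ , here))))
  ∈-terms allC h (con c) _ V = leaves⊆terms h (∈-++⁺ʳ (map var xs) (∈-map⁺ con (allC c)))
  ∈-terms allC (suc h) (t · s) (s≤s ≤h) V = ∈-++⁺ʳ leaves (∈-cartesianProductWith⁺ _·_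
    (∈-terms allC h t (≤-trans (m≤m⊔n _ _) ≤h) (λ x (_ , o) → V x (_ , left o)))
    (∈-terms allC h s (≤-trans (m≤n⊔m _ _) ≤h) (λ x (_ , o) → V x (_ , right o))))

module HierarchicalCLS (𝒞 : CLS) (hier : IsHierarchical 𝒞) where
  open CLS 𝒞

  rhs-occurs : ∀ X j → OccursAt (rhs X) j (order X ∸ toℕ j)
  rhs-occurs X j = proj₁ (hier X j)

  order≤height-rhs : ∀ X (σ : Fin (order X) → Term 𝒞) → order X ≤ height (subst σ (rhs X))
  order≤height-rhs X σ = ≤-trans (m≤m+n _ _)
    (reindexDepth (cong (order X ∸_) (toℕ-fromℕ< (order≥1 X))) (height-subst-≥ σ (rhs-occurs X x₁)))
    where x₁ = fromℕ< (order≥1 X)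

  height-rule : ∀ X (σ : Fin (order X) → Term 𝒞) →
                height (applyArgs (con X) (order X) σ) ≡ height (subst σ (rhs X))
  height-rule X σ = ≤-antisym
    (height-applyArgs-≤ X (order X) σ (order≤height-rhs X σ) (λ i → height-subst-≥ σ (rhs-occurs X i)))
    (height-subst-≤ σ (rhs X) λ j d o →
      reindexDepth (sym (proj₂ (hier X j) d o)) (height-applyArgs-≥ X (order X) σ j))

  sameVars-rule : ∀ X (σ : Fin (order X) → Term 𝒞) →
                  SameVars (applyArgs (con X) (order X) σ) (subst σ (rhs X))
  sameVars-rule X σ x = mk⇔
    (λ x∈lhs → let (i , x∈σi) = ∈ᵥ-applyArgs⁻ X (order X) σ x∈lhs in ∈ᵥ-subst⁺ σ (rhs-occurs X i) x∈σi)
    (λ x∈rhs → let (j , x∈σj) = ∈ᵥ-subst⁻ σ (rhs X) x∈rhs in ∈ᵥ-applyArgs⁺ X (order X) σ j x∈σj)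

  ⇒-height : ∀ {t t′} → _⇒_ 𝒞 t t′ → height t ≡ height t′
  ⇒-height (rule X σ)          = height-rule X σ
  ⇒-height (appL {s = s} t⇒t′) = cong (λ h → suc (h ⊔ height s)) (⇒-height t⇒t′)
  ⇒-height (appR {t = t} s⇒s′) = cong (λ h → suc (height t ⊔ h)) (⇒-height s⇒s′)

  ⇒-sameVars : ∀ {t t′} → _⇒_ 𝒞 t t′ → SameVars t t′
  ⇒-sameVars (rule X σ)  = sameVars-rule X σ
  ⇒-sameVars (appL t⇒t′) = ·-sameVars (⇒-sameVars t⇒t′) (IsEquivalence.refl sameVars-isEquivalence)
  ⇒-sameVars (appR s⇒s′) = ·-sameVars (IsEquivalence.refl sameVars-isEquivalence) (⇒-sameVars s⇒s′)

  ≋-height : ∀ {t s} → _≋_ 𝒞 t s → height t ≡ height s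
  ≋-height = gfold isEquivalence height ⇒-height

  ≋-sameVars : ∀ {t s} → _≋_ 𝒞 t s → SameVars t s
  ≋-sameVars = gfold sameVars-isEquivalence id ⇒-sameVars

  locallyFinite : LocallyFinite 𝒞
  locallyFinite t = terms (allFin k) (vars t) (height t) , λ s t≋s →
    ∈-terms (allFin k) (vars t) ∈-allFin (height t) s (≤-reflexive (sym (≋-height t≋s)))
      (λ x x∈s → ∈-vars t (Equivalence.from (≋-sameVars t≋s x) x∈s))

proposition1p2p3 : (𝒞 : CLS) → IsHierarchical 𝒞 →
    LocallyFinite 𝒞 × (∀ t s → _≋_ 𝒞 t s → height t ≡ height s)
proposition1p2p3 𝒞 hier = locallyFinite , λ _ _ → ≋-height
  where open HierarchicalCLS 𝒞 hier
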